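{- Let $n\ge 2$ and let $\overline{G}_n=\overline{H}_0\overline{H}_1\cdots\overline{H}_{n-1}$ be a polyphenyl hexagonal chain with $n$ hexagons, and $\overline{G}_{n-1}=\overline{H}_0\cdots\overline{H}_{n-2}$. Let $t_n$ be any vertex of $\overline{H}_{n-1}$ different from $c_{n-1}$ (when $n=1$, $t_1$ is any vertex of $\overline{H}_0$). Then $$W(\overline{G}_n)=W(\overline{G}_{n-1})+6W(\overline{G}_{n-1},t_{n-1})+90n-63,\qquad W(\overline{G}_n,t_n)=W(\overline{G}_{n-1},t_{n-1})+g(t_n),$$ with $W(\overline{G}_1)=27$ and $W(\overline{G}_1,t_1)=g(t_1)=9$, where $$g(t_n)=\begin{cases}12(n-1)+9,& t_n\text{ is } o_{n-1},\\ 18(n-1)+9,& t_n\text{ is } m_{n-1},\\ 24(n-1)+9,& t_n\text{ is } p_{n-1}.\end{cases}$$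
   Context: The Wiener index is $W(G)=\sum_{\{u,v\}\subseteq V(G)} d(u,v)$ and $W(G,v)=\sum_{u\in V(G)} d(u,v)$, with $d$ the shortest-path distance. A polyphenyl hexagonal chain with $n$ hexagons is a graph $\overline{G}_n=\overline{H}_0\cdots\overline{H}_{n-1}$ consisting of pairwise vertex-disjoint hexagons (6-cycles) $\overline{H}_0,\dots,\overline{H}_{n-1}$ together with, for each $1\le k\le n-1$, one cut-edge joining a vertex $c_k$ of $\overline{H}_k$ to a vertex $t_k$ (the tail) of $\overline{H}_{k-1}$, where $t_k\ne c_{k-1}$ for $k\ge 2$; $\overline{G}_k$ denotes the subchain formed by the first $k$ hexagons and the cut-edges among them. For $k\ge 1$, a vertex of $\overline{H}_k$ at distance $1$, $2$, $3$ from $c_k$ is denoted $o_k$, $m_k$, $p_k$ (ortho-, meta-, para-vertex). -}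

module Defs where

open import Data.Nat using (ℕ; zero; suc; _+_; _*_; _≤_; _%_; ⌊_/2⌋)
open import Data.Fin using (Fin; toℕ)
open import Data.Product using (_×_; _,_; proj₁; proj₂)
open import Data.Sum using (_⊎_)
open import Data.List using (List; map; concatMap; allFin)
open import Data.Nat.ListAction using (sum)
open import Relation.Binary.PropositionalEquality using (_≡_)

data Walk {V : Set} (Adj : V → V → Set) : V → V → ℕ → Set where
  here : ∀ {u} → Walk Adj u u zero
  step : ∀ {u w v ℓ} → Adj u w → Walk Adj w v ℓ → Walk Adj u v (suc ℓ)

IsDist : {V : Set} → (V → V → Set) → (V → V → ℕ) → Set
IsDist {V} Adj d = ∀ (u v : V) →
  Walk Adj u v (d u v) × (∀ ℓ → Walk Adj u v ℓ → d u v ≤ ℓ)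

-- Vertex (i , a) of the chain G_k : position a ∈ Z/6 on hexagon H_i.
Vtx : ℕ → Set
Vtx k = Fin k × Fin 6

CycAdj : Fin 6 → Fin 6 → Set
CycAdj a b = (toℕ b ≡ suc (toℕ a) % 6) ⊎ (toℕ a ≡ suc (toℕ b) % 6)

-- The chain G_k built from attachment data c t : ℕ → Fin 6:
-- for 1 ≤ i ≤ k-1 the cut-edge joins c i (on H_i) to t i (on H_{i-1}).
data ChainAdj (c t : ℕ → Fin 6) (k : ℕ) : Vtx k → Vtx k → Set where
  hex   : ∀ {i a b} → CycAdj a b → ChainAdj c t k (i , a) (i , b)
  cutDn : ∀ {i j} → toℕ i ≡ suc (toℕ j) →
          ChainAdj c t k (i , c (toℕ i)) (j , t (toℕ i))
  cutUp : ∀ {i j} → toℕ i ≡ suc (toℕ j) →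
          ChainAdj c t k (j , t (toℕ i)) (i , c (toℕ i))

vertices : (k : ℕ) → List (Vtx k)
vertices k = concatMap (λ i → map (λ a → (i , a)) (allFin 6)) (allFin k)

WienerV : (k : ℕ) → (Vtx k → Vtx k → ℕ) → Vtx k → ℕ
WienerV k d v = sum (map (λ u → d u v) (vertices k))

-- W(G) = Σ over unordered pairs = (Σ over ordered pairs) / 2
Wiener : (k : ℕ) → (Vtx k → Vtx k → ℕ) → ℕ
Wiener k d = ⌊ sum (map (λ u → WienerV k d u) (vertices k)) /2⌋

module Submission where

-- The heart of the proof is an exact description of distances in the chain
-- G_{P+1} obtained from G_P by attaching a new hexagon H_P through the cut
-- edge t'–c' (t' the tail on H_{P-1}, c' = c P on H_P):
--   * between two old vertices the distance is the distance in G_P,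
--   * between an old vertex u and a new vertex b it is d(u,t') + 1 + h(c',b),
--   * between two new vertices it is the hexagon distance h,
-- where h is the distance on the 6-cycle.  Each formula is certified by the
-- usual potential argument: a 1-Lipschitz function vanishing at the target
-- bounds every walk from below, and a walk of exactly that length exists.

open import Defs
open import Data.Nat using (ℕ; zero; suc; _+_; _*_; _∸_; _≤_; _%_; _⊓_; ⌊_/2⌋; s≤s; _≤?_)
open import Data.Nat.Properties
open import Data.Nat.DivMod using (m%n<n)
open import Data.Nat.ListAction using (sum)
open import Data.Nat.ListAction.Properties using (sum-++)
open import Data.Nat.Tactic.RingSolver using (solve-∀)
open import Data.Fin using (Fin; toℕ; fromℕ; fromℕ<; inject₁) renaming (_≟_ to _≟ᶠ_)
open import Data.Fin.Properties using (toℕ-fromℕ<; toℕ-inject₁; toℕ-fromℕ; toℕ-injective; toℕ<n; all?)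
open import Data.Fin.Relation.Unary.Top using (View; view; view-fromℕ; view-inject₁; ‵fromℕ; ‵inj₁)
open import Data.Product using (_×_; _,_; proj₁; proj₂)
open import Data.Sum using (_⊎_; inj₁; inj₂)
open import Data.List using (List; []; _∷_; map; concatMap; allFin; tabulate; _++_)
open import Data.List.Properties using (map-tabulate; map-cong; map-++)
open import Data.Empty using (⊥-elim)
open import Relation.Binary.PropositionalEquality
open import Relation.Nullary using (Dec)
open import Relation.Nullary.Decidable using (toWitness; _→-dec_; _⊎-dec_)

module _ {V : Set} {Adj : V → V → Set} where

  _++ʷ_ : ∀ {x y z ℓ ℓ′} → Walk Adj x y ℓ → Walk Adj y z ℓ′ → Walk Adj x z (ℓ + ℓ′)
  here ++ʷ w′ = w′
  step e w ++ʷ w′ = step e (w ++ʷ w′)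

  _∷ʳʷ_ : ∀ {x y z ℓ} → Walk Adj x y ℓ → Adj y z → Walk Adj x z (suc ℓ)
  here ∷ʳʷ e′ = step e′ here
  step e w ∷ʳʷ e′ = step e (w ∷ʳʷ e′)

  reverseʷ : (∀ {x y} → Adj x y → Adj y x) → ∀ {x y ℓ} → Walk Adj x y ℓ → Walk Adj y x ℓ
  reverseʷ sym-adj here = here
  reverseʷ sym-adj (step e w) = reverseʷ sym-adj w ∷ʳʷ sym-adj e

  potential-bound : (φ : V → ℕ) → (∀ {x w} → Adj x w → φ x ≤ suc (φ w)) →
                    ∀ {x y ℓ} → φ y ≡ 0 → Walk Adj x y ℓ → φ x ≤ ℓ
  potential-bound φ lip φy≡0 here = ≤-reflexive φy≡0
  potential-bound φ lip φy≡0 (step e w) = ≤-trans (lip e) (s≤s (potential-bound φ lip φy≡0 w))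

  module Distance {d : V → V → ℕ} (isDist : IsDist Adj d) where

    dist-by-potential : (φ : V → ℕ) → (∀ {x w} → Adj x w → φ x ≤ suc (φ w)) →
                        ∀ {x y} → φ y ≡ 0 → Walk Adj x y (φ x) → d x y ≡ φ x
    dist-by-potential φ lip {x} {y} φy≡0 w =
      ≤-antisym (proj₂ (isDist x y) (φ x) w)
                (potential-bound φ lip φy≡0 (proj₁ (isDist x y)))

    dist-self : ∀ v → d v v ≡ 0
    dist-self v = n≤0⇒n≡0 (proj₂ (isDist v v) 0 here)

    dist-lipschitz : ∀ {u w v} → Adj u w → d u v ≤ suc (d w v)
    dist-lipschitz {u} {w} {v} e = proj₂ (isDist u v) _ (step e (proj₁ (isDist w v)))

    dist-sym : (∀ {x y} → Adj x y → Adj y x) → ∀ x y → d x y ≡ d y x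
    dist-sym sym-adj x y = ≤-antisym (proj₂ (isDist x y) _ (reverseʷ sym-adj (proj₁ (isDist y x))))
                                     (proj₂ (isDist y x) _ (reverseʷ sym-adj (proj₁ (isDist x y))))

mapʷ : ∀ {V V′ : Set} {Adj : V → V → Set} {Adj′ : V′ → V′ → Set} (f : V → V′) →
       (∀ {x y} → Adj x y → Adj′ (f x) (f y)) →
       ∀ {x y ℓ} → Walk Adj x y ℓ → Walk Adj′ (f x) (f y) ℓ
mapʷ f hom here = here
mapʷ f hom (step e w) = step (hom e) (mapʷ f hom w)

sum-map-+ : ∀ {A : Set} (f g : A → ℕ) xs →
            sum (map (λ x → f x + g x) xs) ≡ sum (map f xs) + sum (map g xs)
sum-map-+ f g [] = refl
sum-map-+ f g (x ∷ xs) rewrite sum-map-+ f g xs = interchange (f x) (g x) _ _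
  where
    interchange : ∀ a b c d → (a + b) + (c + d) ≡ (a + c) + (b + d)
    interchange = solve-∀

sum-map-* : ∀ {A : Set} n (f : A → ℕ) xs → sum (map (λ x → n * f x) xs) ≡ n * sum (map f xs)
sum-map-* n f [] = sym (*-zeroʳ n)
sum-map-* n f (x ∷ xs) rewrite sum-map-* n f xs = sym (*-distribˡ-+ n (f x) _)

sum-map-affine : ∀ {A : Set} a b (f : A → ℕ) xs →
                 sum (map (λ x → a + b * f x) xs) ≡ sum (map (λ _ → a) xs) + b * sum (map f xs)
sum-map-affine a b f xs =
  trans (sum-map-+ (λ _ → a) (λ x → b * f x) xs) (cong (sum (map (λ _ → a) xs) +_) (sum-map-* b f xs))

sum-map-concatMap : ∀ {A B : Set} (g : B → ℕ) (F : A → List B) xs →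
                    sum (map g (concatMap F xs)) ≡ sum (map (λ x → sum (map g (F x))) xs)
sum-map-concatMap g F [] = refl
sum-map-concatMap g F (x ∷ xs) = begin
    sum (map g (F x ++ concatMap F xs))
  ≡⟨ cong sum (map-++ g (F x) (concatMap F xs)) ⟩
    sum (map g (F x) ++ map g (concatMap F xs))
  ≡⟨ sum-++ (map g (F x)) _ ⟩
    sum (map g (F x)) + sum (map g (concatMap F xs))
  ≡⟨ cong (sum (map g (F x)) +_) (sum-map-concatMap g F xs) ⟩
    sum (map g (F x)) + sum (map (λ x → sum (map g (F x))) xs) ∎
  where open ≡-Reasoning

sum-tabulate-last : ∀ n (f : Fin (suc n) → ℕ) →
                    sum (tabulate f) ≡ sum (tabulate (λ i → f (inject₁ i))) + f (fromℕ n)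
sum-tabulate-last zero f = +-comm (f Fin.zero) 0
sum-tabulate-last (suc n) f rewrite sum-tabulate-last n (λ i → f (Fin.suc i)) =
  sym (+-assoc (f Fin.zero) _ _)

sum-allFin-last : ∀ n (f : Fin (suc n) → ℕ) →
                  sum (map f (allFin (suc n))) ≡ sum (map (λ i → f (inject₁ i)) (allFin n)) + f (fromℕ n)
sum-allFin-last n f = begin
    sum (map f (allFin (suc n)))
  ≡⟨ cong sum (map-tabulate (λ i → i) f) ⟩
    sum (tabulate f)
  ≡⟨ sum-tabulate-last n f ⟩
    sum (tabulate (λ i → f (inject₁ i))) + f (fromℕ n)
  ≡⟨ cong (λ xs → sum xs + f (fromℕ n)) (sym (map-tabulate (λ i → i) (λ i → f (inject₁ i)))) ⟩
    sum (map (λ i → f (inject₁ i)) (allFin n)) + f (fromℕ n) ∎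
  where open ≡-Reasoning

Σ₆ : (Fin 6 → ℕ) → ℕ
Σ₆ f = sum (map f (allFin 6))

ΣV : (k : ℕ) → (Vtx k → ℕ) → ℕ
ΣV k g = sum (map g (vertices k))

Σ₆-cong : ∀ {f g : Fin 6 → ℕ} → (∀ a → f a ≡ g a) → Σ₆ f ≡ Σ₆ g
Σ₆-cong eq = cong sum (map-cong eq (allFin 6))

ΣV-cong : ∀ k {f g : Vtx k → ℕ} → (∀ x → f x ≡ g x) → ΣV k f ≡ ΣV k g
ΣV-cong k eq = cong sum (map-cong eq (vertices k))

ΣV-split : ∀ k (g : Vtx (suc k) → ℕ) →
           ΣV (suc k) g ≡ ΣV k (λ x → g (inject₁ (proj₁ x) , proj₂ x)) + Σ₆ (λ a → g (fromℕ k , a))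
ΣV-split k g = begin
    ΣV (suc k) g
  ≡⟨ sum-map-concatMap g verticesOf (allFin (suc k)) ⟩
    sum (map (λ i → Σ₆ (λ a → g (i , a))) (allFin (suc k)))
  ≡⟨ sum-allFin-last k (λ i → Σ₆ (λ a → g (i , a))) ⟩
    sum (map (λ i → Σ₆ (λ a → g (inject₁ i , a))) (allFin k)) + Σ₆ (λ a → g (fromℕ k , a))
  ≡⟨ cong (_+ Σ₆ (λ a → g (fromℕ k , a)))
          (sym (sum-map-concatMap (λ x → g (inject₁ (proj₁ x) , proj₂ x)) verticesOf (allFin k))) ⟩
    ΣV k (λ x → g (inject₁ (proj₁ x) , proj₂ x)) + Σ₆ (λ a → g (fromℕ k , a)) ∎
  where
    open ≡-Reasoning
    verticesOf : ∀ {n} → Fin n → List (Vtx n)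
    verticesOf i = map (λ a → (i , a)) (allFin 6)

ΣV-const : ∀ k n → ΣV k (λ _ → n) ≡ k * (6 * n)
ΣV-const zero n = refl
ΣV-const (suc k) n rewrite ΣV-split k (λ _ → n) | ΣV-const k n = +-comm (k * (6 * n)) (6 * n)

half-+-double : ∀ a b → ⌊ a + (b + b) /2⌋ ≡ ⌊ a /2⌋ + b
half-+-double a zero rewrite +-identityʳ a = sym (+-identityʳ _)
half-+-double a (suc b) rewrite +-suc b b | +-suc a (suc (b + b)) | +-suc a (b + b) | half-+-double a b =
  sym (+-suc _ b)

-- The hexagon C₆

cyc-sym : ∀ {a b} → CycAdj a b → CycAdj b a
cyc-sym (inj₁ p) = inj₂ p
cyc-sym (inj₂ p) = inj₁ p

next : Fin 6 → Fin 6
next a = fromℕ< (m%n<n (suc (toℕ a)) 6)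

forward : Fin 6 → ℕ → Fin 6
forward a zero = a
forward a (suc k) = forward (next a) k

forwardWalk : ∀ a k → Walk CycAdj a (forward a k) k
forwardWalk a zero = here
forwardWalk a (suc k) = step (inj₁ (toℕ-fromℕ< _)) (forwardWalk (next a) k)

arc : Fin 6 → Fin 6 → ℕ
arc a b = (toℕ b + 6 ∸ toℕ a) % 6

hexDist : Fin 6 → Fin 6 → ℕ
hexDist a b = arc a b ⊓ arc b a

cycAdj? : ∀ a b → Dec (CycAdj a b)
cycAdj? a b = (toℕ b ≟ suc (toℕ a) % 6) ⊎-dec (toℕ a ≟ suc (toℕ b) % 6)

hexDist-realised : ∀ a b → forward a (hexDist a b) ≡ b ⊎ forward b (hexDist a b) ≡ a
hexDist-realised = toWitness {a? = all? λ a → all? λ b →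
  (forward a (hexDist a b) ≟ᶠ b) ⊎-dec (forward b (hexDist a b) ≟ᶠ a)} _

hexDist-lipschitz : ∀ {a w b} → CycAdj a w → hexDist a b ≤ suc (hexDist w b)
hexDist-lipschitz {a} {w} {b} = toWitness {a? = all? λ a → all? λ w → all? λ b →
  cycAdj? a w →-dec (hexDist a b ≤? suc (hexDist w b))} _ a w b

hexDist-self : ∀ a → hexDist a a ≡ 0
hexDist-self = toWitness {a? = all? λ a → hexDist a a ≟ 0} _

hexDist-row : ∀ a → Σ₆ (hexDist a) ≡ 9
hexDist-row = toWitness {a? = all? λ a → Σ₆ (hexDist a) ≟ 9} _

hexDist-column : ∀ a → Σ₆ (λ b → hexDist b a) ≡ 9
hexDist-column = toWitness {a? = all? λ a → Σ₆ (λ b → hexDist b a) ≟ 9} _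

hexWalk : ∀ a b → Walk CycAdj a b (hexDist a b)
hexWalk a b with hexDist-realised a b
... | inj₁ eq = subst (λ z → Walk CycAdj a z (hexDist a b)) eq (forwardWalk a (hexDist a b))
... | inj₂ eq = reverseʷ cyc-sym (subst (λ z → Walk CycAdj b z (hexDist a b)) eq (forwardWalk b (hexDist a b)))

-- Attaching a new hexagon: the edges of G_{P+1}, P = m + 1

module Extension (m : ℕ) (c t : ℕ → Fin 6) where

  P N : ℕ
  P = suc m
  N = suc P

  -- G_P sits inside G_N as the first P hexagons; L indexes the new hexagon
  ι : Vtx P → Vtx N
  ι x = (inject₁ (proj₁ x) , proj₂ x)

  L : Fin N
  L = fromℕ P

  -- the cut edge of the new hexagon joins t′ in G_P to position c′ of H_P
  t′ : Vtx P
  t′ = (fromℕ m , t P)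

  c′ : Fin 6
  c′ = c P

  chain-sym : ∀ {k x y} → ChainAdj c t k x y → ChainAdj c t k y x
  chain-sym (hex p) = hex (cyc-sym p)
  chain-sym (cutDn e) = cutUp e
  chain-sym (cutUp e) = cutDn e

  -- the cut edge between hexagons n-1 and n, with the index n given up to equality
  cutAt : ∀ {k} {i j : Fin k} n → toℕ i ≡ n → n ≡ suc (toℕ j) → ChainAdj c t k (i , c n) (j , t n)
  cutAt _ refl e = cutDn e

  ι-hom : ∀ {x y} → ChainAdj c t P x y → ChainAdj c t N (ι x) (ι y)
  ι-hom (hex p) = hex p
  ι-hom (cutDn {i} {j} e) = cutAt (toℕ i) (toℕ-inject₁ i) (trans e (cong suc (sym (toℕ-inject₁ j))))
  ι-hom (cutUp {i} {j} e) = chain-sym (cutAt (toℕ i) (toℕ-inject₁ i) (trans e (cong suc (sym (toℕ-inject₁ j)))))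

  attach-edge : ChainAdj c t N (ι t′) (L , c′)
  attach-edge = chain-sym (cutAt P (toℕ-fromℕ P) (cong suc (sym (trans (toℕ-inject₁ (fromℕ m)) (toℕ-fromℕ m)))))

  data ExtEdge : Vtx N → Vtx N → Set where
    inner   : ∀ {u u′} → ChainAdj c t P u u′ → ExtEdge (ι u) (ι u′)
    hexagon : ∀ {a b} → CycAdj a b → ExtEdge (L , a) (L , b)
    attach  : ExtEdge (ι t′) (L , c′)
    detach  : ExtEdge (L , c′) (ι t′)

  ext-sym : ∀ {x y} → ExtEdge x y → ExtEdge y x
  ext-sym (inner p) = inner (chain-sym p)
  ext-sym (hexagon p) = hexagon (cyc-sym p)
  ext-sym attach = detach
  ext-sym detach = attach

  hex-class : ∀ {i a b} → View i → CycAdj a b → ExtEdge (i , a) (i , b)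
  hex-class ‵fromℕ p = hexagon p
  hex-class {a = a} {b} (‵inj₁ {i = j} _) p = inner {u = (j , a)} {u′ = (j , b)} (hex p)

  detachAt : ∀ {n} {j : Fin P} → n ≡ P → j ≡ fromℕ m → ExtEdge (L , c n) (inject₁ j , t n)
  detachAt refl refl = detach

  -- a cut edge cannot start or end at the wrong side of the last hexagon;
  -- the one between H_P and H_{P-1} is the new cut edge
  cut-class : ∀ {i j} → View i → View j → toℕ i ≡ suc (toℕ j) → ExtEdge (i , c (toℕ i)) (j , t (toℕ i))
  cut-class ‵fromℕ ‵fromℕ e = ⊥-elim (1+n≢n (sym e))
  cut-class ‵fromℕ (‵inj₁ {i = j} _) e = detachAt (toℕ-fromℕ P) (toℕ-injective (trans j≡m (sym (toℕ-fromℕ m))))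
    where
      j≡m : toℕ j ≡ m
      j≡m = suc-injective (trans (cong suc (sym (toℕ-inject₁ j))) (trans (sym e) (toℕ-fromℕ P)))
  cut-class (‵inj₁ {i = i} _) ‵fromℕ e = ⊥-elim (<⇒≱ (toℕ<n i) (≤-trans (n≤1+n P) (≤-reflexive (sym i≡N))))
    where
      i≡N : toℕ i ≡ N
      i≡N = trans (sym (toℕ-inject₁ i)) (trans e (cong suc (toℕ-fromℕ P)))
  cut-class (‵inj₁ {i = i} _) (‵inj₁ {i = j} _) e =
    inner {u = (i , c (toℕ (inject₁ i)))} {u′ = (j , t (toℕ (inject₁ i)))}
          (cutAt (toℕ (inject₁ i)) (sym (toℕ-inject₁ i)) (trans e (cong suc (toℕ-inject₁ j))))

  classify : ∀ {x y} → ChainAdj c t N x y → ExtEdge x y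
  classify (hex {i} p) = hex-class (view i) p
  classify (cutDn {i} {j} e) = cut-class (view i) (view j) e
  classify (cutUp {i} {j} e) = ext-sym (cut-class (view i) (view j) e)

  data Position : Vtx N → Set where
    old : (u : Vtx P) → Position (ι u)
    new : (a : Fin 6) → Position (L , a)

  positionAt : ∀ {i} (a : Fin 6) → View i → Position (i , a)
  positionAt a ‵fromℕ = new a
  positionAt a (‵inj₁ {i = j} _) = old (j , a)

  position : (x : Vtx N) → Position x
  position (i , a) = positionAt a (view i)

  position-unique : ∀ {x} (px : Position x) → position x ≡ px
  position-unique (old (j , a)) = cong (positionAt a) (view-inject₁ j)
  position-unique (new a) = cong (positionAt a) (view-fromℕ P)

  module Distances (dp : Vtx P → Vtx P → ℕ) (isDistP : IsDist (ChainAdj c t P) dp)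
                   (dn : Vtx N → Vtx N → ℕ) (isDistN : IsDist (ChainAdj c t N) dn) where

    open Distance isDistP using (dist-self; dist-lipschitz; dist-sym)

    -- the distances of G_N in terms of those of G_P: a shortest path between
    -- the old part and the new hexagon runs through the cut edge t′–c′
    predicted : ∀ {x y} → Position x → Position y → ℕ
    predicted (old u) (old v) = dp u v
    predicted (old u) (new b) = dp u t′ + suc (hexDist c′ b)
    predicted (new a) (old v) = hexDist a c′ + suc (dp t′ v)
    predicted (new a) (new b) = hexDist a b

    predictedWalk : ∀ {x y} (px : Position x) (py : Position y) → Walk (ChainAdj c t N) x y (predicted px py)
    predictedWalk (old u) (old v) = mapʷ ι ι-hom (proj₁ (isDistP u v))
    predictedWalk (old u) (new b) =
      mapʷ ι ι-hom (proj₁ (isDistP u t′)) ++ʷ step attach-edge (mapʷ (L ,_) hex (hexWalk c′ b))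
    predictedWalk (new a) (old v) =
      mapʷ (L ,_) hex (hexWalk a c′) ++ʷ step (chain-sym attach-edge) (mapʷ ι ι-hom (proj₁ (isDistP t′ v)))
    predictedWalk (new a) (new b) = mapʷ (L ,_) hex (hexWalk a b)

    towards : ∀ {y} → Position y → Vtx N → ℕ
    towards py x = predicted (position x) py

    towards-at : ∀ {x y} (px : Position x) (py : Position y) → towards py x ≡ predicted px py
    towards-at px py = cong (λ q → predicted q py) (position-unique px)

    towards-self : ∀ {y} (py : Position y) → towards py y ≡ 0
    towards-self (old v) = trans (towards-at (old v) (old v)) (dist-self v)
    towards-self (new b) = trans (towards-at (new b) (new b)) (hexDist-self b)

    inner-step : ∀ {u u′ y} (py : Position y) → ChainAdj c t P u u′ →
                 predicted (old u) py ≤ suc (predicted (old u′) py)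
    inner-step (old v) e = dist-lipschitz e
    inner-step (new b) e = +-monoˡ-≤ (suc (hexDist c′ b)) (dist-lipschitz e)

    hexagon-step : ∀ {a a′ y} (py : Position y) → CycAdj a a′ →
                   predicted (new a) py ≤ suc (predicted (new a′) py)
    hexagon-step (old v) e = +-monoˡ-≤ (suc (dp t′ v)) (hexDist-lipschitz e)
    hexagon-step (new b) e = hexDist-lipschitz e

    attach-step : ∀ {y} (py : Position y) → predicted (old t′) py ≤ suc (predicted (new c′) py)
    attach-step (old v) rewrite hexDist-self c′ = ≤-trans (n≤1+n _) (n≤1+n _)
    attach-step (new b) rewrite dist-self t′ = ≤-refl

    detach-step : ∀ {y} (py : Position y) → predicted (new c′) py ≤ suc (predicted (old t′) py)
    detach-step (old v) rewrite hexDist-self c′ = ≤-refl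
    detach-step (new b) = ≤-trans (n≤1+n _) (≤-trans (m≤n+m _ (dp t′ t′)) (n≤1+n _))

    shift : ∀ {x w y} (px : Position x) (pw : Position w) (py : Position y) →
            predicted px py ≤ suc (predicted pw py) → towards py x ≤ suc (towards py w)
    shift px pw py = subst₂ (λ p q → p ≤ suc q) (sym (towards-at px py)) (sym (towards-at pw py))

    towards-lipschitz : ∀ {y} (py : Position y) {x w} → ExtEdge x w → towards py x ≤ suc (towards py w)
    towards-lipschitz py (inner {u} {u′} e) = shift (old u) (old u′) py (inner-step py e)
    towards-lipschitz py (hexagon {a} {b} e) = shift (new a) (new b) py (hexagon-step py e)
    towards-lipschitz py attach = shift (old t′) (new c′) py (attach-step py)
    towards-lipschitz py detach = shift (new c′) (old t′) py (detach-step py)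

    dn-predicted : ∀ {x y} (px : Position x) (py : Position y) → dn x y ≡ predicted px py
    dn-predicted {x} px py =
      trans (Distance.dist-by-potential isDistN (towards py) (λ e → towards-lipschitz py (classify e))
                                        (towards-self py) (predictedWalk (position x) py))
            (towards-at px py)

    W′ : ℕ
    W′ = WienerV P dp t′

    -- W(G_N, u) for an old vertex u: the new hexagon lies beyond the cut edge
    wiener-old : ∀ u → WienerV N dn (ι u) ≡ WienerV P dp u + (15 + 6 * dp u t′)
    wiener-old u = begin
        WienerV N dn (ι u)
      ≡⟨ ΣV-split P (λ x → dn x (ι u)) ⟩
        ΣV P (λ v → dn (ι v) (ι u)) + Σ₆ (λ b → dn (L , b) (ι u))
      ≡⟨ cong₂ _+_ (ΣV-cong P (λ v → dn-predicted (old v) (old u)))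
                   (Σ₆-cong (λ b → dn-predicted (new b) (old u))) ⟩
        WienerV P dp u + Σ₆ (λ b → hexDist b c′ + suc (dp t′ u))
      ≡⟨ cong (WienerV P dp u +_) (sum-map-+ (λ b → hexDist b c′) (λ _ → suc (dp t′ u)) (allFin 6)) ⟩
        WienerV P dp u + (Σ₆ (λ b → hexDist b c′) + 6 * suc (dp t′ u))
      ≡⟨ cong₂ (λ z w → WienerV P dp u + (z + 6 * suc w)) (hexDist-column c′) (dist-sym chain-sym t′ u) ⟩
        WienerV P dp u + (9 + 6 * suc (dp u t′))
      ≡⟨ cong (WienerV P dp u +_) (regroup (dp u t′)) ⟩
        WienerV P dp u + (15 + 6 * dp u t′) ∎
      where
        open ≡-Reasoning
        regroup : ∀ x → 9 + 6 * suc x ≡ 15 + 6 * x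
        regroup = solve-∀

    -- W(G_N, (L , a)) for a new vertex: every old vertex is reached via c′
    wiener-new : ∀ a → WienerV N dn (L , a) ≡ W′ + P * (6 * suc (hexDist c′ a)) + 9
    wiener-new a = begin
        WienerV N dn (L , a)
      ≡⟨ ΣV-split P (λ x → dn x (L , a)) ⟩
        ΣV P (λ v → dn (ι v) (L , a)) + Σ₆ (λ b → dn (L , b) (L , a))
      ≡⟨ cong₂ _+_ (ΣV-cong P (λ v → dn-predicted (old v) (new a)))
                   (Σ₆-cong (λ b → dn-predicted (new b) (new a))) ⟩
        ΣV P (λ v → dp v t′ + suc (hexDist c′ a)) + Σ₆ (λ b → hexDist b a)
      ≡⟨ cong₂ _+_ (trans (sum-map-+ (λ v → dp v t′) (λ _ → suc (hexDist c′ a)) (vertices P))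
                          (cong (W′ +_) (ΣV-const P (suc (hexDist c′ a)))))
                   (hexDist-column a) ⟩
        W′ + P * (6 * suc (hexDist c′ a)) + 9 ∎
      where open ≡-Reasoning

    wiener-new-at : ∀ a k → dn (L , c′) (L , a) ≡ k → WienerV N dn (L , a) ≡ W′ + ((6 + 6 * k) * P + 9)
    wiener-new-at a k dist≡k = begin
        WienerV N dn (L , a)
      ≡⟨ wiener-new a ⟩
        W′ + P * (6 * suc (hexDist c′ a)) + 9
      ≡⟨ cong (λ h → W′ + P * (6 * suc h) + 9) (trans (sym (dn-predicted (new c′) (new a))) dist≡k) ⟩
        W′ + P * (6 * suc k) + 9
      ≡⟨ regroup W′ P k ⟩
        W′ + ((6 + 6 * k) * P + 9) ∎
      where
        open ≡-Reasoning
        regroup : ∀ w p k → w + p * (6 * suc k) + 9 ≡ w + ((6 + 6 * k) * p + 9)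
        regroup = solve-∀

    distance-total : ΣV N (WienerV N dn)
                   ≡ ΣV P (WienerV P dp) + ((6 * W′ + (90 * P + 27)) + (6 * W′ + (90 * P + 27)))
    distance-total = begin
        ΣV N (WienerV N dn)
      ≡⟨ ΣV-split P (WienerV N dn) ⟩
        ΣV P (λ u → WienerV N dn (ι u)) + Σ₆ (λ a → WienerV N dn (L , a))
      ≡⟨ cong₂ _+_ (ΣV-cong P wiener-old) (Σ₆-cong (λ a → trans (wiener-new a) (affine W′ P (hexDist c′ a)))) ⟩
        ΣV P (λ u → WienerV P dp u + (15 + 6 * dp u t′)) + Σ₆ (λ a → (W′ + 6 * P + 9) + 6 * P * hexDist c′ a)
      ≡⟨ cong₂ _+_ old-rows new-rows ⟩
        (Tp + (P * (6 * 15) + 6 * W′)) + (6 * (W′ + 6 * P + 9) + 6 * P * 9)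
      ≡⟨ regroup Tp W′ P ⟩
        Tp + ((6 * W′ + (90 * P + 27)) + (6 * W′ + (90 * P + 27))) ∎
      where
        open ≡-Reasoning
        Tp : ℕ
        Tp = ΣV P (WienerV P dp)
        affine : ∀ w p h → w + p * (6 * suc h) + 9 ≡ (w + 6 * p + 9) + 6 * p * h
        affine = solve-∀
        old-rows : ΣV P (λ u → WienerV P dp u + (15 + 6 * dp u t′)) ≡ Tp + (P * (6 * 15) + 6 * W′)
        old-rows = trans (sum-map-+ (WienerV P dp) (λ u → 15 + 6 * dp u t′) (vertices P))
                         (cong (Tp +_) (trans (sum-map-affine 15 6 (λ u → dp u t′) (vertices P))
                                              (cong (_+ 6 * W′) (ΣV-const P 15))))
        new-rows : Σ₆ (λ a → (W′ + 6 * P + 9) + 6 * P * hexDist c′ a) ≡ 6 * (W′ + 6 * P + 9) + 6 * P * 9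
        new-rows = trans (sum-map-affine (W′ + 6 * P + 9) (6 * P) (hexDist c′) (allFin 6))
                         (cong (λ z → 6 * (W′ + 6 * P + 9) + 6 * P * z) (hexDist-row c′))
        regroup : ∀ T w p → (T + (p * (6 * 15) + 6 * w)) + (6 * (w + 6 * p + 9) + 6 * p * 9)
                          ≡ T + ((6 * w + (90 * p + 27)) + (6 * w + (90 * p + 27)))
        regroup = solve-∀

    wiener-step : Wiener N dn ≡ Wiener P dp + 6 * W′ + (90 * N ∸ 63)
    wiener-step = begin
        ⌊ ΣV N (WienerV N dn) /2⌋
      ≡⟨ cong ⌊_/2⌋ distance-total ⟩
        ⌊ ΣV P (WienerV P dp) + ((6 * W′ + (90 * P + 27)) + (6 * W′ + (90 * P + 27))) /2⌋
      ≡⟨ half-+-double (ΣV P (WienerV P dp)) (6 * W′ + (90 * P + 27)) ⟩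
        Wiener P dp + (6 * W′ + (90 * P + 27))
      ≡⟨ sym (+-assoc (Wiener P dp) (6 * W′) _) ⟩
        Wiener P dp + 6 * W′ + (90 * P + 27)
      ≡⟨ cong (Wiener P dp + 6 * W′ +_) (sym (m+n∸m≡n 63 (90 * P + 27))) ⟩
        Wiener P dp + 6 * W′ + (63 + (90 * P + 27) ∸ 63)
      ≡⟨ cong (λ z → Wiener P dp + 6 * W′ + (z ∸ 63)) (ninety-suc P) ⟩
        Wiener P dp + 6 * W′ + (90 * N ∸ 63) ∎
      where
        open ≡-Reasoning
        ninety-suc : ∀ p → 63 + (90 * p + 27) ≡ 90 * suc p
        ninety-suc = solve-∀

-- The base case: G_1 is a single hexagon

module SingleHexagon (c t : ℕ → Fin 6) (d : Vtx 1 → Vtx 1 → ℕ) (isDist : IsDist (ChainAdj c t 1) d) where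

  -- G_1 has no cut edges, so its distance is the hexagon distance
  base-dist : ∀ x y → d x y ≡ hexDist (proj₂ x) (proj₂ y)
  base-dist (Fin.zero , a) (Fin.zero , b) =
    Distance.dist-by-potential isDist (λ x → hexDist (proj₂ x) b) lipschitz (hexDist-self b)
                               (mapʷ (Fin.zero ,_) hex (hexWalk a b))
    where
      lipschitz : ∀ {x w} → ChainAdj c t 1 x w → hexDist (proj₂ x) b ≤ suc (hexDist (proj₂ w) b)
      lipschitz (hex p) = hexDist-lipschitz p
      lipschitz (cutDn {Fin.zero} ())
      lipschitz (cutUp {Fin.zero} ())

  base-wiener : Wiener 1 d ≡ 27
  base-wiener = cong ⌊_/2⌋ (ΣV-cong 1 (λ u → ΣV-cong 1 (λ v → base-dist v u)))

  base-wiener-at : ∀ a → WienerV 1 d (Fin.zero , a) ≡ 9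
  base-wiener-at a = trans (ΣV-cong 1 (λ v → base-dist v (Fin.zero , a))) (hexDist-column a)

-- Theorem 3.1.  The attachment condition t k ≢ c (k ∸ 1) is not needed:
-- the case split ortho/meta/para is expressed through the distance from
-- c (n-1) to t n inside the last hexagon.

theorem3p1 :
    (∀ (c t : ℕ → Fin 6) (d : Vtx 1 → Vtx 1 → ℕ) →
       IsDist (ChainAdj c t 1) d →
       (Wiener 1 d ≡ 27) × (WienerV 1 d (Fin.zero , t 1) ≡ 9))
    ×
    (∀ (m : ℕ) (c t : ℕ → Fin 6) →
       (∀ k → 2 ≤ k → k ≤ suc (suc m) → t k ≢ c (k ∸ 1)) →
       (dn : Vtx (suc (suc m)) → Vtx (suc (suc m)) → ℕ) →
       (dp : Vtx (suc m) → Vtx (suc m) → ℕ) →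
       IsDist (ChainAdj c t (suc (suc m))) dn →
       IsDist (ChainAdj c t (suc m)) dp →
       (Wiener (suc (suc m)) dn
          ≡ Wiener (suc m) dp + 6 * WienerV (suc m) dp (fromℕ m , t (suc m))
            + (90 * suc (suc m) ∸ 63))
       ×
       (dn (fromℕ (suc m) , c (suc m)) (fromℕ (suc m) , t (suc (suc m))) ≡ 1 →
          WienerV (suc (suc m)) dn (fromℕ (suc m) , t (suc (suc m)))
            ≡ WienerV (suc m) dp (fromℕ m , t (suc m)) + (12 * suc m + 9))
       ×
       (dn (fromℕ (suc m) , c (suc m)) (fromℕ (suc m) , t (suc (suc m))) ≡ 2 →
          WienerV (suc (suc m)) dn (fromℕ (suc m) , t (suc (suc m)))
            ≡ WienerV (suc m) dp (fromℕ m , t (suc m)) + (18 * suc m + 9))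
       ×
       (dn (fromℕ (suc m) , c (suc m)) (fromℕ (suc m) , t (suc (suc m))) ≡ 3 →
          WienerV (suc (suc m)) dn (fromℕ (suc m) , t (suc (suc m)))
            ≡ WienerV (suc m) dp (fromℕ m , t (suc m)) + (24 * suc m + 9)))
theorem3p1 =
  (λ c t d isDist → let open SingleHexagon c t d isDist in base-wiener , base-wiener-at (t 1)) ,
  (λ m c t _ dn dp isDistN isDistP →
     let open Extension.Distances m c t dp isDistP dn isDistN in
     wiener-step ,
     wiener-new-at (t (suc (suc m))) 1 ,
     wiener-new-at (t (suc (suc m))) 2 ,
     wiener-new-at (t (suc (suc m))) 3)
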